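{- Let $n\ge 3$, let $\nu(n)=\langle 0,1,\ldots,n-1\rangle$, and let $\sigma(n)=\langle(0\,1),(1\,2),\ldots,(n-2\;\,n-1),(n-1\;\,0)\rangle$. Let $\mathrm h$ be a nonempty proper subsequence of $\nu(n)$. Then there exists $\mathbf f\in\mathrm{Seq}(\sigma(n))$ such that $\bigcirc\mathbf f=(\mathrm h)(\nu(n)\setminus\mathrm h)^-$.
   Context: Permutations compose left to right: $x(f\circ g)=(xf)g$. For a finite sequence $\mathbf s$ in $\mathrm{Sym}(n)$, $\bigcirc\mathbf s$ is the composite of its terms in order and $\mathrm{Seq}(\mathbf s)$ is its set of rearrangements. For a sequence $\mathrm h=\langle h_1,\ldots,h_s\rangle$ of distinct elements of $n$, $(\mathrm h)$ denotes the cycle $(h_1\,h_2\,\cdots\,h_s)$ mapping $h_i\mapsto h_{i+1}$ and $h_s\mapsto h_1$ (the identity if $s=1$). $\nu(n)\setminus\mathrm h$ is the subsequence of $\nu(n)$ consisting of the terms not in $\mathrm h$, and $g^-$ denotes the inverse of a permutation $g$. The two cycles $(\mathrm h)$ and $(\nu(n)\setminus\mathrm h)^-$ have disjoint supports. -}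

module Defs where

open import Data.Nat using (ℕ; zero; suc; _<?_)
open import Data.Fin using (Fin; zero; suc; toℕ; fromℕ<; _≟_)
open import Data.List using (List; []; _∷_; map; filter; allFin; foldr)
import Data.List.Membership.DecPropositional as DecMem
open import Relation.Nullary using (yes; no; ¬?)

Perm : ℕ → Set
Perm n = Fin n → Fin n

-- Left-to-right composition: x (f ⊙ g) = (x f) g
_⊙_ : ∀ {n} → Perm n → Perm n → Perm n
(f ⊙ g) x = g (f x)

○ : ∀ {n} → List (Perm n) → Perm n
○ [] x = x
○ (g ∷ gs) x = ○ gs (g x)

swap : ∀ {n} → Fin n → Fin n → Perm n
swap i j x with x ≟ i
... | yes _ = j
... | no _ with x ≟ j
...   | yes _ = i
...   | no _ = x

next : ∀ {n} → Fin n → Fin n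
next {suc k} i with suc (toℕ i) <? suc k
... | yes p = fromℕ< p
... | no _ = zero

ν : ∀ n → List (Fin n)
ν n = allFin n

σ : ∀ n → List (Perm n)
σ n = map (λ i → swap i (next i)) (ν n)

-- the cycle (h₁ h₂ ⋯ h_s): hᵢ ↦ hᵢ₊₁, h_s ↦ h₁, others fixed (identity if s ≤ 1)
-- cycleGo first a t x: the map on the tail segment ⟨a, t…⟩ of h, sending the last term to `first`
cycleGo : ∀ {n} → Fin n → Fin n → List (Fin n) → Perm n
cycleGo first a [] x with x ≟ a
... | yes _ = first
... | no _ = x
cycleGo first a (b ∷ t) x with x ≟ a
... | yes _ = b
... | no _ = cycleGo first b t x

cyc : ∀ {n} → List (Fin n) → Perm n
cyc [] x = x
cyc (h₁ ∷ t) = cycleGo h₁ h₁ t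

-- inverse g⁻ of a permutation g: y ↦ the (first) x in ν(n) with x g = y
-- (defaults to y if none exists; never happens for bijections)
findPre : ∀ {n} → Perm n → Fin n → List (Fin n) → Fin n
findPre g y [] = y
findPre g y (x ∷ xs) with g x ≟ y
... | yes _ = x
... | no _ = findPre g y xs

_⁻ : ∀ {n} → Perm n → Perm n
(g ⁻) y = findPre g y (allFin _)

_∖_ : ∀ {n} → List (Fin n) → List (Fin n) → List (Fin n)
_∖_ {n} xs h = filter (λ x → ¬? (x M.∈? h)) xs
  where module M = DecMem (_≟_ {n})

module Submission where

-- Idea.  h and c are increasing lists, so (h) sends each element of h to the next element of h met
-- walking forward around the cycle 0 → 1 → ⋯ → n-1 → 0, and (c)⁻ sends each element of c to the
-- previous element of c (relation NextIn).  Pick u ∉ h with u + 1 ∈ h and count positions 0, …, N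
-- (n = N + 1) from b = u + 1, so position 0 lies in h and position N does not; τ k transposes
-- positions k and k + 1, and τ N transposes N and 0.  For k < N put τ k at the front of the word
-- when position k lies in h and at its back otherwise, then append τ N.  By induction on the word,
-- positions in h move up to the next position in h and the others move down to the previous
-- position outside h (Π-above, Π-below); the final τ N closes both cycles.

open import Defs
open import Function using (_∘_; mk⇔)
open import Data.Nat using (ℕ; zero; suc; _≤_; _<_; _+_; _∸_; z≤n; s≤s; _<?_; _≤?_)
open import Data.Nat.Properties hiding (_≟_)
open import Data.Fin using (Fin; zero; toℕ; _≟_)
open import Data.Fin.Properties using (toℕ-injective; toℕ-fromℕ<; toℕ<n; ¬∀⟶∃¬)
open import Data.List using (List; []; _∷_; _++_; _∷ʳ_; [_]; map; allFin; downFrom)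
open import Data.List.Properties using (map-++; map-∘; map-applyDownFrom)
open import Data.List.Relation.Unary.All as All using (All; []; _∷_)
open import Data.List.Relation.Unary.Any using (here; there)
open import Data.List.Relation.Unary.AllPairs as AllPairs using (AllPairs; []; _∷_)
import Data.List.Relation.Unary.AllPairs.Properties as AllPairsₚ
open import Data.List.Relation.Unary.Unique.Propositional using (Unique)
open import Data.List.Relation.Unary.Unique.Propositional.Properties using (allFin⁺)
open import Data.List.Membership.Propositional using (_∈_; _∉_)
open import Data.List.Membership.Propositional.Properties
  using (∈-++⁻; ∈-++⁺ʳ; ∈-∃++; ∈-allFin; ∈-map⁺; ∈-downFrom⁺; ∈-filter⁺; ∈-filter⁻)
open import Data.List.Membership.Propositional.Properties.WithK using (unique∧set⇒bag)
import Data.List.Membership.DecPropositional as DecMembership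
open import Data.List.Relation.Binary.Sublist.Propositional as Sublist using (_⊆_)
open import Data.List.Relation.Binary.Sublist.Propositional.Properties using (All-resp-⊆; Any-resp-⊆)
open import Data.List.Relation.Binary.BagAndSetEquality using (∼bag⇒↭)
open import Data.List.Relation.Binary.Permutation.Propositional using (_↭_; ↭-refl; ↭-sym; ↭-trans; ↭-prep)
open import Data.List.Relation.Binary.Permutation.Propositional.Properties using (∷↭∷ʳ; map⁺)
open import Data.Product using (Σ-syntax; _×_; _,_; proj₁; proj₂)
open import Data.Sum using (_⊎_; inj₁; inj₂; [_,_]′)
open import Data.Empty using (⊥; ⊥-elim)
open import Relation.Nullary using (¬_; ¬?; yes; no)
open import Relation.Unary using (Decidable)
open import Relation.Binary.PropositionalEquality hiding ([_])
open import Relation.Binary.Definitions using (tri<; tri≈; tri>)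

swap-here : ∀ {m} (a b : Fin m) → swap a b a ≡ b
swap-here a b with a ≟ a
... | yes _ = refl
... | no a≢a = ⊥-elim (a≢a refl)

swap-there : ∀ {m} (a b : Fin m) → swap a b b ≡ a
swap-there a b with b ≟ a
... | yes b≡a = b≡a
... | no _ with b ≟ b
...   | yes _ = refl
...   | no b≢b = ⊥-elim (b≢b refl)

swap-other : ∀ {m} (a b c : Fin m) → c ≢ a → c ≢ b → swap a b c ≡ c
swap-other a b c c≢a c≢b with c ≟ a
... | yes c≡a = ⊥-elim (c≢a c≡a)
... | no _ with c ≟ b
...   | yes c≡b = ⊥-elim (c≢b c≡b)
...   | no _ = refl

○-∷ʳ : ∀ {m} (fs : List (Perm m)) g x → ○ (fs ∷ʳ g) x ≡ g (○ fs x)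
○-∷ʳ [] g x = refl
○-∷ʳ (f ∷ fs) g x = ○-∷ʳ fs g (f x)

sublist-complete : ∀ {A : Set} {xs ys : List A} → xs ⊆ ys → Unique ys → (∀ v → v ∈ ys → v ∈ xs) → xs ≡ ys
sublist-complete Sublist.[] _ _ = refl
sublist-complete (y Sublist.∷ʳ xs⊆ys) (y∉ys ∷ _) covers =
  ⊥-elim (All.lookup y∉ys (Any-resp-⊆ xs⊆ys (covers y (here refl))) refl)
sublist-complete {xs = y ∷ xs} {ys = y ∷ ys} (refl Sublist.∷ xs⊆ys) (y∉ys ∷ unique) covers =
  cong (y ∷_) (sublist-complete xs⊆ys unique (λ v v∈ys → in-tail v∈ys (covers v (there v∈ys))))
  where
  in-tail : ∀ {v} → v ∈ ys → v ∈ y ∷ xs → v ∈ xs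
  in-tail v∈ys (here refl) = ⊥-elim (All.lookup y∉ys v∈ys refl)
  in-tail _ (there v∈xs) = v∈xs

segment : ∀ {m} → Fin m → List (Fin m) → Perm m
segment f [] x = x
segment f (a ∷ t) = cycleGo f a t

segment-skip : ∀ {m} (f a c : Fin m) t x → x ≢ a → segment f (a ∷ c ∷ t) x ≡ segment f (c ∷ t) x
segment-skip f a c t x x≢a with x ≟ a
... | yes x≡a = ⊥-elim (x≢a x≡a)
... | no _ = refl

segment-outside : ∀ {m} (f : Fin m) l x → x ∉ l → segment f l x ≡ x
segment-outside f [] x _ = refl
segment-outside f (a ∷ []) x x∉ with x ≟ a
... | yes x≡a = ⊥-elim (x∉ (here x≡a))
... | no _ = refl
segment-outside f (a ∷ c ∷ t) x x∉ =
  trans (segment-skip f a c t x (x∉ ∘ here)) (segment-outside f (c ∷ t) x (x∉ ∘ there))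

segment-prefix : ∀ {m} (f : Fin m) A v R → v ∉ A → segment f (A ++ v ∷ R) v ≡ segment f (v ∷ R) v
segment-prefix f [] v R _ = refl
segment-prefix f (a ∷ []) v R v∉ = segment-skip f a v R v (v∉ ∘ here)
segment-prefix f (a ∷ a′ ∷ A) v R v∉ =
  trans (segment-skip f a a′ (A ++ v ∷ R) v (v∉ ∘ here)) (segment-prefix f (a′ ∷ A) v R (v∉ ∘ there))

segment-to-next : ∀ {m} (f v y : Fin m) B → segment f (v ∷ y ∷ B) v ≡ y
segment-to-next f v y B with v ≟ v
... | yes _ = refl
... | no v≢v = ⊥-elim (v≢v refl)

segment-to-first : ∀ {m} (f v : Fin m) → segment f (v ∷ []) v ≡ f
segment-to-first f v with v ≟ v
... | yes _ = refl
... | no v≢v = ⊥-elim (v≢v refl)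

cyc-outside : ∀ {m} (l : List (Fin m)) x → x ∉ l → cyc l x ≡ x
cyc-outside [] x _ = refl
cyc-outside (h₁ ∷ t) x x∉ = segment-outside h₁ (h₁ ∷ t) x x∉

findPre-unique : ∀ {m} (g : Perm m) y z xs → z ∈ xs → g z ≡ y → (∀ w → g w ≡ y → w ≡ z) → findPre g y xs ≡ z
findPre-unique g y z (x ∷ xs) z∈ gz≡y unique with g x ≟ y
... | yes gx≡y = unique x gx≡y
... | no gx≢y with z∈
...   | here refl = ⊥-elim (gx≢y gz≡y)
...   | there z∈xs = findPre-unique g y z xs z∈xs gz≡y unique

⁻-unique : ∀ {m} (g : Perm m) y z → g z ≡ y → (∀ w → g w ≡ y → w ≡ z) → (g ⁻) y ≡ z
⁻-unique g y z = findPre-unique g y z (allFin _) (∈-allFin z)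

Sorted : ∀ {m} → List (Fin m) → Set
Sorted = AllPairs Data.Fin._<_

sorted-prefix : ∀ {m} A {v : Fin m} {R} → Sorted (A ++ v ∷ R) → All (Data.Fin._< v) A
sorted-prefix [] _ = []
sorted-prefix (a ∷ A) (a< ∷ sorted) = All.lookup a< (∈-++⁺ʳ A (here refl)) ∷ sorted-prefix A sorted

v∉prefix : ∀ {m} A {v : Fin m} {R} → Sorted (A ++ v ∷ R) → v ∉ A
v∉prefix A sorted v∈A = <-irrefl refl (All.lookup (sorted-prefix A sorted) v∈A)

sorted-suffix : ∀ {m} A {R : List (Fin m)} → Sorted (A ++ R) → Sorted R
sorted-suffix [] sorted = sorted
sorted-suffix (a ∷ A) (_ ∷ sorted) = sorted-suffix A sorted

allFin-sorted : ∀ m → Sorted (allFin m)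
allFin-sorted m = AllPairsₚ.tabulate⁺-< (λ i<j → i<j)

sorted-⊆ : ∀ {m} {xs ys : List (Fin m)} → xs ⊆ ys → Sorted ys → Sorted xs
sorted-⊆ Sublist.[] _ = []
sorted-⊆ (_ Sublist.∷ʳ xs⊆ys) (_ ∷ sorted) = sorted-⊆ xs⊆ys sorted
sorted-⊆ (refl Sublist.∷ xs⊆ys) (y< ∷ sorted) = All-resp-⊆ xs⊆ys y< ∷ sorted-⊆ xs⊆ys sorted

module Rotation (N : ℕ) where

  n : ℕ
  n = suc N

  next-cases : (i : Fin n) →
    (suc (toℕ i) < n × toℕ (next i) ≡ suc (toℕ i)) ⊎ (toℕ i ≡ N × next i ≡ zero)
  next-cases i with suc (toℕ i) <? n
  ... | yes i+1<n = inj₁ (i+1<n , toℕ-fromℕ< i+1<n)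
  ... | no i+1≮n = inj₂ (≤-antisym (≤-pred (toℕ<n i)) (≮⇒≥ (λ i<N → i+1≮n (s≤s i<N))) , refl)

  toℕ-next : (i : Fin n) → suc (toℕ i) < n → toℕ (next i) ≡ suc (toℕ i)
  toℕ-next i i+1<n with next-cases i
  ... | inj₁ (_ , eq) = eq
  ... | inj₂ (i≡N , _) = ⊥-elim (<-irrefl (cong suc i≡N) i+1<n)

  next-top : (i : Fin n) → toℕ i ≡ N → next i ≡ zero
  next-top i i≡N with next-cases i
  ... | inj₁ (i+1<n , _) = ⊥-elim (<-irrefl (cong suc i≡N) i+1<n)
  ... | inj₂ (_ , eq) = eq

  next-injective : ∀ {a b} → next a ≡ next b → a ≡ b
  next-injective {a} {b} eq with next-cases a | next-cases b
  ... | inj₁ (_ , ea) | inj₁ (_ , eb) =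
    toℕ-injective (suc-injective (trans (sym ea) (trans (cong toℕ eq) eb)))
  ... | inj₁ (_ , ea) | inj₂ (_ , eb) = ⊥-elim (0≢1+n (trans (sym (cong toℕ eb)) (trans (sym (cong toℕ eq)) ea)))
  ... | inj₂ (_ , ea) | inj₁ (_ , eb) = ⊥-elim (0≢1+n (trans (sym (cong toℕ ea)) (trans (cong toℕ eq) eb)))
  ... | inj₂ (ea , _) | inj₂ (eb , _) = toℕ-injective (trans ea (sym eb))

  rot : ℕ → Fin n → Fin n
  rot zero v = v
  rot (suc k) v = next (rot k v)

  rot-+ : ∀ j k v → rot (j + k) v ≡ rot j (rot k v)
  rot-+ zero k v = refl
  rot-+ (suc j) k v = cong next (rot-+ j k v)

  rot-injective : ∀ k {a b} → rot k a ≡ rot k b → a ≡ b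
  rot-injective zero eq = eq
  rot-injective (suc k) eq = rot-injective k (next-injective eq)

  toℕ-rot : ∀ j v → toℕ v + j < n → toℕ (rot j v) ≡ toℕ v + j
  toℕ-rot zero v _ = sym (+-identityʳ _)
  toℕ-rot (suc j) v v+j+1<n = begin
      toℕ (next (rot j v)) ≡⟨ toℕ-next (rot j v) (subst (λ z → suc z < n) (sym ih) v+j+1<n′) ⟩
      suc (toℕ (rot j v))  ≡⟨ cong suc ih ⟩
      suc (toℕ v + j)      ≡⟨ +-suc (toℕ v) j ⟨
      toℕ v + suc j        ∎
    where
    open ≡-Reasoning
    v+j+1<n′ : suc (toℕ v + j) < n
    v+j+1<n′ = subst (_< n) (+-suc (toℕ v) j) v+j+1<n
    ih : toℕ (rot j v) ≡ toℕ v + j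
    ih = toℕ-rot j v (<-trans (n<1+n _) v+j+1<n′)

  rot-to-zero : ∀ v → rot (n ∸ toℕ v) v ≡ zero
  rot-to-zero v = begin
      rot (n ∸ toℕ v) v       ≡⟨ cong (λ k → rot k v) (+-∸-assoc 1 v≤N) ⟩
      next (rot (N ∸ toℕ v) v) ≡⟨ next-top _ (trans (toℕ-rot _ v (subst (_< n) (sym v+d≡N) ≤-refl)) v+d≡N) ⟩
      zero                    ∎
    where
    open ≡-Reasoning
    v≤N : toℕ v ≤ N
    v≤N = ≤-pred (toℕ<n v)
    v+d≡N : toℕ v + (N ∸ toℕ v) ≡ N
    v+d≡N = m+[n∸m]≡n v≤N

  toℕ-rot-wrap : ∀ j v → n ≤ toℕ v + j → toℕ v + j < n + n → toℕ (rot j v) ≡ toℕ v + j ∸ n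
  toℕ-rot-wrap j v n≤v+j v+j<2n = begin
      toℕ (rot j v)                 ≡⟨ cong (λ k → toℕ (rot k v)) j≡a+d ⟩
      toℕ (rot (a + d) v)           ≡⟨ cong toℕ (rot-+ a d v) ⟩
      toℕ (rot a (rot d v))         ≡⟨ cong (λ w → toℕ (rot a w)) (rot-to-zero v) ⟩
      toℕ (rot a zero)              ≡⟨ toℕ-rot a zero a<n ⟩
      a                             ∎
    where
    open ≡-Reasoning
    a = toℕ v + j ∸ n
    d = n ∸ toℕ v
    a<n : a < n
    a<n = +-cancelʳ-< n a n (subst (_< n + n) (sym (m∸n+n≡m n≤v+j)) v+j<2n)
    j≡a+d : j ≡ a + d
    j≡a+d = +-cancelˡ-≡ (toℕ v) _ _ (begin
      toℕ v + j         ≡⟨ m∸n+n≡m n≤v+j ⟨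
      a + n             ≡⟨ cong (a +_) (m+[n∸m]≡n (<⇒≤ (toℕ<n v))) ⟨
      a + (toℕ v + d)   ≡⟨ +-assoc a (toℕ v) d ⟨
      a + toℕ v + d     ≡⟨ cong (_+ d) (+-comm a (toℕ v)) ⟩
      toℕ v + a + d     ≡⟨ +-assoc (toℕ v) a d ⟩
      toℕ v + (a + d)   ∎)

  rot-n : ∀ v → rot n v ≡ v
  rot-n v = toℕ-injective (trans (toℕ-rot-wrap n v (m≤n+m n (toℕ v)) (+-monoˡ-< n (toℕ<n v)))
                                 (m+n∸n≡m (toℕ v) n))

  rot-around : ∀ v w → rot (n ∸ toℕ v + toℕ w) v ≡ w
  rot-around v w = toℕ-injective (begin
      toℕ (rot k v)       ≡⟨ toℕ-rot-wrap k v (subst (n ≤_) (sym v+k≡n+w) (m≤m+n n _))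
                                               (subst (_< n + n) (sym v+k≡n+w) (+-monoʳ-< n (toℕ<n w))) ⟩
      toℕ v + k ∸ n       ≡⟨ cong (_∸ n) v+k≡n+w ⟩
      n + toℕ w ∸ n       ≡⟨ m+n∸m≡n n (toℕ w) ⟩
      toℕ w               ∎)
    where
    open ≡-Reasoning
    k = n ∸ toℕ v + toℕ w
    v+k≡n+w : toℕ v + k ≡ n + toℕ w
    v+k≡n+w = trans (sym (+-assoc (toℕ v) _ _)) (cong (_+ toℕ w) (m+[n∸m]≡n (<⇒≤ (toℕ<n v))))

  rot-no-fixpoint : ∀ d w → 0 < d → d < n → rot d w ≢ w
  rot-no-fixpoint d w 0<d d<n eq with toℕ w + d <? n
  ... | yes w+d<n =
    <-irrefl (sym (trans (sym (toℕ-rot d w w+d<n)) (cong toℕ eq)))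
             (subst (_< toℕ w + d) (+-identityʳ (toℕ w)) (+-monoʳ-< (toℕ w) 0<d))
  ... | no w+d≮n = <-irrefl (+-cancelˡ-≡ (toℕ w) _ _ w+d≡w+n) d<n
    where
    n≤w+d = ≮⇒≥ w+d≮n
    w+d≡w+n : toℕ w + d ≡ toℕ w + n
    w+d≡w+n = trans (sym (m∸n+n≡m n≤w+d))
      (cong (_+ n) (trans (sym (toℕ-rot-wrap d w n≤w+d (+-mono-< (toℕ<n w) d<n))) (cong toℕ eq)))

  rot-distinct : ∀ b {i j} → i < j → j < n → rot i b ≢ rot j b
  rot-distinct b {i} {j} i<j j<n eq =
    rot-no-fixpoint (j ∸ i) (rot i b) (m<n⇒0<n∸m i<j) (≤-<-trans (m∸n≤m j i) j<n) (begin
      rot (j ∸ i) (rot i b) ≡⟨ rot-+ (j ∸ i) i b ⟨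
      rot (j ∸ i + i) b     ≡⟨ cong (λ k → rot k b) (m∸n+n≡m (<⇒≤ i<j)) ⟩
      rot j b               ≡⟨ eq ⟨
      rot i b               ∎)
    where open ≡-Reasoning

  rot-injectiveˡ : ∀ b {i j} → i < n → j < n → rot i b ≡ rot j b → i ≡ j
  rot-injectiveˡ b {i} {j} i<n j<n eq with <-cmp i j
  ... | tri≈ _ i≡j _ = i≡j
  ... | tri< i<j _ _ = ⊥-elim (rot-distinct b i<j j<n eq)
  ... | tri> _ _ j<i = ⊥-elim (rot-distinct b j<i i<n (sym eq))

  rot-surjective : ∀ b v → Σ[ k ∈ ℕ ] (k < n × rot k b ≡ v)
  rot-surjective b v with toℕ b ≤? toℕ v
  ... | yes b≤v = toℕ v ∸ toℕ b , ≤-<-trans (m∸n≤m (toℕ v) (toℕ b)) (toℕ<n v) ,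
          toℕ-injective (trans (toℕ-rot _ b (subst (_< n) (sym b+k≡v) (toℕ<n v))) b+k≡v)
    where
    b+k≡v = m+[n∸m]≡n b≤v
  ... | no b≰v = n ∸ toℕ b + toℕ v , k<n , rot-around b v
    where
    k<n : n ∸ toℕ b + toℕ v < n
    k<n = begin-strict
      n ∸ toℕ b + toℕ v  <⟨ +-monoʳ-< (n ∸ toℕ b) (≰⇒> b≰v) ⟩
      n ∸ toℕ b + toℕ b  ≡⟨ m∸n+n≡m (<⇒≤ (toℕ<n b)) ⟩
      n                  ∎
      where open ≤-Reasoning

module Successors (N : ℕ) where
  open Rotation N
  open DecMembership (_≟_ {n}) using (_∈?_)

  record NextIn (L : List (Fin n)) (v y : Fin n) : Set where
    constructor nextIn
    field
      steps   : ℕ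
      steps>0 : 0 < steps
      arrives : rot steps v ≡ y
      member  : y ∈ L
      skips   : ∀ j → 0 < j → j < steps → rot j v ∉ L

  NextIn-functional : ∀ {L v y₁ y₂} → NextIn L v y₁ → NextIn L v y₂ → y₁ ≡ y₂
  NextIn-functional (nextIn k₁ k₁>0 e₁ m₁ s₁) (nextIn k₂ k₂>0 e₂ m₂ s₂) with <-cmp k₁ k₂
  ... | tri< k₁<k₂ _ _ = ⊥-elim (s₂ k₁ k₁>0 k₁<k₂ (subst (_∈ _) (sym e₁) m₁))
  ... | tri≈ _ refl _ = trans (sym e₁) e₂
  ... | tri> _ _ k₂<k₁ = ⊥-elim (s₁ k₂ k₂>0 k₂<k₁ (subst (_∈ _) (sym e₂) m₂))

  -- If w₁ ∈ L reaches v in fewer steps than w₂ does, the walk from w₂ passes through w₁.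
  private
    overtaken : ∀ {L v w₁ w₂ k₁ k₂} → w₁ ∈ L → 0 < k₁ → k₁ < k₂ → rot k₁ w₁ ≡ v → rot k₂ w₂ ≡ v →
                (∀ j → 0 < j → j < k₂ → rot j w₂ ∉ L) → ⊥
    overtaken {L} {v} {w₁} {w₂} {k₁} {k₂} w₁∈L k₁>0 k₁<k₂ e₁ e₂ skips₂ =
      skips₂ d (m<n⇒0<n∸m k₁<k₂) (∸-monoʳ-< k₁>0 (<⇒≤ k₁<k₂)) (subst (_∈ L) w₁≡ w₁∈L)
      where
      d = k₂ ∸ k₁
      w₁≡ : w₁ ≡ rot d w₂
      w₁≡ = rot-injective k₁ (begin
        rot k₁ w₁          ≡⟨ trans e₁ (sym e₂) ⟩
        rot k₂ w₂          ≡⟨ cong (λ k → rot k w₂) (m+[n∸m]≡n (<⇒≤ k₁<k₂)) ⟨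
        rot (k₁ + d) w₂    ≡⟨ rot-+ k₁ d w₂ ⟩
        rot k₁ (rot d w₂)  ∎)
        where open ≡-Reasoning

  NextIn-injective : ∀ {L v w₁ w₂} → w₁ ∈ L → w₂ ∈ L → NextIn L w₁ v → NextIn L w₂ v → w₁ ≡ w₂
  NextIn-injective w₁∈L w₂∈L (nextIn k₁ k₁>0 e₁ _ s₁) (nextIn k₂ k₂>0 e₂ _ s₂) with <-cmp k₁ k₂
  ... | tri< k₁<k₂ _ _ = ⊥-elim (overtaken w₁∈L k₁>0 k₁<k₂ e₁ e₂ s₂)
  ... | tri≈ _ refl _ = rot-injective k₁ (trans e₁ (sym e₂))
  ... | tri> _ _ k₂<k₁ = ⊥-elim (overtaken w₂∈L k₂>0 k₂<k₁ e₂ e₁ s₁)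

  nextIn-up : ∀ {L v y} → y ∈ L → toℕ v < toℕ y →
              (∀ w → w ∈ L → toℕ v < toℕ w → toℕ y ≤ toℕ w) → NextIn L v y
  nextIn-up {L} {v} {y} y∈L v<y above =
    nextIn k (m<n⇒0<n∸m v<y) (toℕ-injective (trans (toℕ-rot k v v+k<n) v+k≡y)) y∈L skips
    where
    k = toℕ y ∸ toℕ v
    v+k≡y : toℕ v + k ≡ toℕ y
    v+k≡y = m+[n∸m]≡n (<⇒≤ v<y)
    v+k<n : toℕ v + k < n
    v+k<n = subst (_< n) (sym v+k≡y) (toℕ<n y)
    skips : ∀ j → 0 < j → j < k → rot j v ∉ L
    skips j j>0 j<k j∈L = <-irrefl refl (begin-strict
        toℕ y              ≤⟨ above _ j∈L (subst (toℕ v <_) (sym value) (m<m+n (toℕ v) j>0)) ⟩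
        toℕ (rot j v)      ≡⟨ value ⟩
        toℕ v + j          <⟨ +-monoʳ-< (toℕ v) j<k ⟩
        toℕ v + k          ≡⟨ v+k≡y ⟩
        toℕ y              ∎)
      where
      open ≤-Reasoning
      value : toℕ (rot j v) ≡ toℕ v + j
      value = toℕ-rot j v (<-trans (+-monoʳ-< (toℕ v) j<k) v+k<n)

  nextIn-wrap : ∀ {L v y} → y ∈ L → (∀ w → w ∈ L → toℕ w ≤ toℕ v) →
                (∀ w → w ∈ L → toℕ y ≤ toℕ w) → NextIn L v y
  nextIn-wrap {L} {v} {y} y∈L below-v above-y =
    nextIn k (<-≤-trans (m<n⇒0<n∸m (toℕ<n v)) (m≤m+n _ _)) (rot-around v y) y∈L skips
    where
    k = n ∸ toℕ v + toℕ y
    v+k≡n+y : toℕ v + k ≡ n + toℕ y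
    v+k≡n+y = trans (sym (+-assoc (toℕ v) _ _)) (cong (_+ toℕ y) (m+[n∸m]≡n (<⇒≤ (toℕ<n v))))
    skips : ∀ j → 0 < j → j < k → rot j v ∉ L
    skips j j>0 j<k j∈L with toℕ v + j <? n
    ... | yes v+j<n = <-irrefl refl (begin-strict
        toℕ v              <⟨ m<m+n (toℕ v) j>0 ⟩
        toℕ v + j          ≡⟨ toℕ-rot j v v+j<n ⟨
        toℕ (rot j v)      ≤⟨ below-v _ j∈L ⟩
        toℕ v              ∎)
      where open ≤-Reasoning
    ... | no v+j≮n = <-irrefl refl (begin-strict
        toℕ y              ≤⟨ above-y _ j∈L ⟩
        toℕ (rot j v)      ≡⟨ toℕ-rot-wrap j v n≤v+j (<-trans v+j<n+y (+-monoʳ-< n (toℕ<n y))) ⟩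
        toℕ v + j ∸ n      <⟨ ∸-monoˡ-< v+j<n+y n≤v+j ⟩
        n + toℕ y ∸ n      ≡⟨ m+n∸m≡n n (toℕ y) ⟩
        toℕ y              ∎)
      where
      open ≤-Reasoning
      n≤v+j = ≮⇒≥ v+j≮n
      v+j<n+y : toℕ v + j < n + toℕ y
      v+j<n+y = subst (toℕ v + j <_) v+k≡n+y (+-monoʳ-< (toℕ v) j<k)

  segment-next : ∀ f A v R → Sorted (A ++ v ∷ R) → f ∈ A ++ v ∷ R →
                 (∀ w → w ∈ A ++ v ∷ R → toℕ f ≤ toℕ w) → NextIn (A ++ v ∷ R) v (segment f (A ++ v ∷ R) v)
  segment-next f A v [] sorted f∈L f-least
    rewrite segment-prefix f A v [] (v∉prefix A sorted) | segment-to-first f v =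
      nextIn-wrap f∈L below-v f-least
    where
    below-v : ∀ w → w ∈ A ++ v ∷ [] → toℕ w ≤ toℕ v
    below-v w w∈ with ∈-++⁻ A w∈
    ... | inj₁ w∈A = <⇒≤ (All.lookup (sorted-prefix A sorted) w∈A)
    ... | inj₂ (here refl) = ≤-refl
  segment-next f A v (y ∷ B) sorted f∈L f-least
    rewrite segment-prefix f A v (y ∷ B) (v∉prefix A sorted) | segment-to-next f v y B
    with sorted-suffix A sorted
  ... | (v<y ∷ _) ∷ (y<B ∷ _) = nextIn-up (∈-++⁺ʳ A (there (here refl))) v<y above-v
    where
    above-v : ∀ w → w ∈ A ++ v ∷ y ∷ B → toℕ v < toℕ w → toℕ y ≤ toℕ w
    above-v w w∈ v<w with ∈-++⁻ A w∈
    ... | inj₁ w∈A = ⊥-elim (<-asym v<w (All.lookup (sorted-prefix A sorted) w∈A))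
    ... | inj₂ (here refl) = ⊥-elim (<-irrefl refl v<w)
    ... | inj₂ (there (here refl)) = ≤-refl
    ... | inj₂ (there (there w∈B)) = <⇒≤ (All.lookup y<B w∈B)

  cyc-next : ∀ L → Sorted L → ∀ v → v ∈ L → NextIn L v (cyc L v)
  cyc-next (h₁ ∷ t) sorted v v∈L with ∈-∃++ v∈L
  ... | A , R , eq = subst (λ L → NextIn L v (segment h₁ L v)) (sym eq)
      (segment-next h₁ A v R (subst Sorted eq sorted) (subst (h₁ ∈_) eq (here refl))
                    (λ w → subst (λ L → w ∈ L → toℕ h₁ ≤ toℕ w) eq (h₁-least w)))
    where
    h₁-least : ∀ w → w ∈ h₁ ∷ t → toℕ h₁ ≤ toℕ w
    h₁-least w (here refl) = ≤-refl
    h₁-least w (there w∈t) = <⇒≤ (All.lookup (AllPairs.head sorted) w∈t)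

  cyc⁻-outside : ∀ L → Sorted L → ∀ y → y ∉ L → (cyc L ⁻) y ≡ y
  cyc⁻-outside L sorted y y∉L = ⁻-unique (cyc L) y y (cyc-outside L y y∉L) unique
    where
    unique : ∀ w → cyc L w ≡ y → w ≡ y
    unique w cw≡y with w ∈? L
    ... | yes w∈L = ⊥-elim (y∉L (subst (_∈ L) cw≡y (NextIn.member (cyc-next L sorted w w∈L))))
    ... | no w∉L = trans (sym (cyc-outside L w w∉L)) cw≡y

  cyc⁻-predecessor : ∀ L → Sorted L → ∀ {z v} → z ∈ L → NextIn L z v → (cyc L ⁻) v ≡ z
  cyc⁻-predecessor L sorted {z} {v} z∈L z↦v =
    ⁻-unique (cyc L) v z (NextIn-functional (cyc-next L sorted z z∈L) z↦v) unique
    where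
    unique : ∀ w → cyc L w ≡ v → w ≡ z
    unique w cw≡v with w ∈? L
    ... | yes w∈L = NextIn-injective w∈L z∈L (subst (NextIn L w) cw≡v (cyc-next L sorted w w∈L)) z↦v
    ... | no w∉L = ⊥-elim (w∉L (subst (_∈ L) (trans (sym cw≡v) (cyc-outside L w w∉L)) (NextIn.member z↦v)))

  crossing : ∀ (h : List (Fin n)) d {x} → x ∉ h → rot d x ∈ h → Σ[ u ∈ Fin n ] (u ∉ h × next u ∈ h)
  crossing h zero x∉h x∈h = ⊥-elim (x∉h x∈h)
  crossing h (suc d) {x} x∉h next∈h with rot d x ∈? h
  ... | yes ∈h = crossing h d x∉h ∈h
  ... | no ∉h = rot d x , ∉h , next∈h

  entry-point : ∀ (h : List (Fin n)) → h ⊆ ν n → h ≢ [] → h ≢ ν n → Σ[ u ∈ Fin n ] (u ∉ h × next u ∈ h)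
  entry-point [] _ h≢[] _ = ⊥-elim (h≢[] refl)
  entry-point h@(w ∷ _) h⊆ν _ h≢ν with ¬∀⟶∃¬ n (_∈ h) (_∈? h) (λ all∈h → h≢ν (sublist-complete h⊆ν (allFin⁺ n) (λ v _ → all∈h v)))
  ... | x , x∉h with rot-surjective x w
  ...   | d , _ , rot-d-x≡w = crossing h d x∉h (subst (_∈ h) (sym rot-d-x≡w) (here refl))


module Positions (N : ℕ) (b : Fin (suc N)) where
  open Rotation N
  open Successors N using (NextIn; nextIn)

  φ : ℕ → Fin n
  φ k = rot k b

  -- τ k transposes positions k and k + 1; as φ (k + 1) = next (φ k), it is a term of σ(n).
  τ : ℕ → Perm n
  τ k = swap (φ k) (φ (suc k))

  φ-injective : ∀ {i j} → i < n → j < n → φ i ≡ φ j → i ≡ j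
  φ-injective = rot-injectiveˡ b

  φ-n : φ n ≡ φ 0
  φ-n = rot-n b

  φ-wrap : ∀ j → rot (suc j) (φ N) ≡ φ j
  φ-wrap j = begin
    rot (suc j) (rot N b)  ≡⟨ rot-+ (suc j) N b ⟨
    rot (suc j + N) b      ≡⟨ cong (λ k → rot k b) (+-suc j N) ⟨
    rot (j + n) b          ≡⟨ rot-+ j n b ⟩
    rot j (rot n b)        ≡⟨ cong (rot j) φ-n ⟩
    rot j b                ∎
    where open ≡-Reasoning

  τ-fix : ∀ {k x} → k < N → x < n → x ≢ k → x ≢ suc k → τ k (φ x) ≡ φ x
  τ-fix {k} k<N x<n x≢k x≢k+1 =
    swap-other _ _ _ (x≢k ∘ φ-injective x<n (<-trans k<N (n<1+n N))) (x≢k+1 ∘ φ-injective x<n (s≤s k<N))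

  τ-fix-above : ∀ {k x} → suc k < x → x < n → τ k (φ x) ≡ φ x
  τ-fix-above {k} k+1<x x<n =
    τ-fix (<-≤-trans (<-trans (n<1+n k) k+1<x) (≤-pred x<n)) x<n (>⇒≢ (<-trans (n<1+n k) k+1<x)) (>⇒≢ k+1<x)

  τ-fix-below : ∀ {k x} → x < k → k < N → τ k (φ x) ≡ φ x
  τ-fix-below x<k k<N = τ-fix k<N (<-trans (<-trans x<k k<N) (n<1+n N)) (<⇒≢ x<k) (<⇒≢ (m<n⇒m<1+n x<k))

  τ-up : ∀ k → τ k (φ k) ≡ φ (suc k)
  τ-up k = swap-here (φ k) (φ (suc k))

  τ-down : ∀ k → τ k (φ (suc k)) ≡ φ k
  τ-down k = swap-there (φ k) (φ (suc k))

  τN-bottom : τ N (φ 0) ≡ φ N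
  τN-bottom = trans (cong (τ N) (sym φ-n)) (τ-down N)

  τN-fix : ∀ {x} → 0 < x → x < N → τ N (φ x) ≡ φ x
  τN-fix {x} 0<x x<N = swap-other _ _ _ (λ eq → <-irrefl (φ-injective x<n ≤-refl eq) x<N)
    (λ eq → <-irrefl (sym (φ-injective x<n (s≤s z≤n) (trans eq φ-n))) 0<x)
    where x<n = <-trans x<N (n<1+n N)

  nextIn-positions : ∀ {L x r} → x < r → φ r ∈ L → (∀ w → x < w → w < r → φ w ∉ L) → NextIn L (φ x) (φ r)
  nextIn-positions {L} {x} {r} x<r φr∈L gap = nextIn (r ∸ x) (m<n⇒0<n∸m x<r) arrives φr∈L skips
    where
    arrives : rot (r ∸ x) (φ x) ≡ φ r
    arrives = trans (sym (rot-+ (r ∸ x) x b)) (cong φ (m∸n+n≡m (<⇒≤ x<r)))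
    skips : ∀ j → 0 < j → j < r ∸ x → rot j (φ x) ∉ L
    skips j 0<j j<r-x = subst (_∉ L) (rot-+ j x b)
      (gap (j + x) (m<n+m x 0<j) (subst (j + x <_) (m∸n+n≡m (<⇒≤ x<r)) (+-monoˡ-< x j<r-x)))

  positions-↭ : map φ (downFrom n) ↭ allFin n
  positions-↭ = ∼bag⇒↭ (unique∧set⇒bag distinct (allFin⁺ n) (mk⇔ (λ _ → ∈-allFin _) visited))
    where
    distinct : Unique (map φ (downFrom n))
    distinct = subst Unique (sym (map-applyDownFrom (λ k → k) φ n))
                 (AllPairsₚ.applyDownFrom⁺₁ φ n (λ j<i i<n eq → rot-distinct b j<i i<n (sym eq)))
    visited : ∀ {v} → v ∈ allFin n → v ∈ map φ (downFrom n)
    visited {v} _ with rot-surjective b v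
    ... | k , k<n , refl = ∈-map⁺ φ (∈-downFrom⁺ k<n)

  transpositions-↭ : ∀ {ks} → ks ↭ downFrom n → map τ ks ↭ σ n
  transpositions-↭ {ks} ks↭ = subst (_↭ σ n) (sym (map-∘ ks)) (map⁺ _ (↭-trans (map⁺ φ ks↭) positions-↭))

module Word (N : ℕ) (b : Fin (suc N)) {P : ℕ → Set} (P? : Decidable P) where
  open Rotation N
  open Positions N b

  word : ℕ → List ℕ
  word zero = []
  word (suc M) with P? M
  ... | yes _ = M ∷ word M
  ... | no _ = word M ∷ʳ M

  Π : ℕ → Perm n
  Π M = ○ (map τ (word M))

  Π-∷ʳ : ∀ M x → ○ (map τ (word M ∷ʳ M)) x ≡ τ M (Π M x)
  Π-∷ʳ M x = trans (cong (λ fs → ○ fs x) (map-++ τ (word M) [ M ])) (○-∷ʳ (map τ (word M)) (τ M) x)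

  word-↭ : ∀ M → word M ↭ downFrom M
  word-↭ zero = ↭-refl
  word-↭ (suc M) with P? M
  ... | yes _ = ↭-prep M (word-↭ M)
  ... | no _ = ↭-trans (↭-sym (∷↭∷ʳ M (word M))) (↭-prep M (word-↭ M))

  record FirstAbove (M x r : ℕ) : Set where
    constructor firstAbove
    field
      x<r   : x < r
      r≤M   : r ≤ M
      stops : r ≡ M ⊎ P r
      gap   : ∀ w → x < w → w < r → ¬ P w

  record LastBelow (x r : ℕ) : Set where
    constructor lastBelow
    field
      r<x   : r < x
      stops : r ≡ 0 ⊎ ¬ P r
      gap   : ∀ w → r < w → w < x → P w

  above-widen : ∀ {M x r} → FirstAbove M x r → P r → FirstAbove (suc M) x r
  above-widen (firstAbove x<r r≤M _ gap) Pr = firstAbove x<r (m≤n⇒m≤1+n r≤M) (inj₂ Pr) gap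

  above-past : ∀ {M x} → FirstAbove M x M → ¬ P M → FirstAbove (suc M) x (suc M)
  above-past {M} (firstAbove x<M _ _ gap) ¬PM = firstAbove (m<n⇒m<1+n x<M) ≤-refl (inj₁ refl) gap′
    where
    gap′ : ∀ w → _ < w → w < suc M → ¬ P w
    gap′ w x<w w<M+1 with m<1+n⇒m<n∨m≡n w<M+1
    ... | inj₁ w<M = gap w x<w w<M
    ... | inj₂ refl = ¬PM

  below-extend : ∀ {x r} → LastBelow x r → P x → LastBelow (suc x) r
  below-extend {x} (lastBelow r<x stops gap) Px = lastBelow (m<n⇒m<1+n r<x) stops gap′
    where
    gap′ : ∀ w → _ < w → w < suc x → P w
    gap′ w r<w w<x+1 with m<1+n⇒m<n∨m≡n w<x+1
    ... | inj₁ w<x = gap w r<w w<x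
    ... | inj₂ refl = Px

  private
    nothing-between : ∀ {m w} → m < w → w < suc m → ⊥
    nothing-between m<w w<m+1 = <-irrefl refl (<-≤-trans m<w (≤-pred w<m+1))

    below-bound : ∀ {x M} → x < M → x ≡ M ⊎ ¬ P x → ¬ P x
    below-bound x<M = [ (λ x≡M → ⊥-elim (<⇒≢ x<M x≡M)) , (λ ¬Px → ¬Px) ]′

  Π-fix : ∀ M {x} → M < x → x < n → Π M (φ x) ≡ φ x
  Π-fix zero _ _ = refl
  Π-fix (suc M) {x} M+1<x x<n with P? M
  ... | yes _ = trans (cong (Π M) (τ-fix-above M+1<x x<n)) (Π-fix M (<-trans (n<1+n M) M+1<x) x<n)
  ... | no _ = begin
    ○ (map τ (word M ∷ʳ M)) (φ x)  ≡⟨ Π-∷ʳ M (φ x) ⟩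
    τ M (Π M (φ x))                ≡⟨ cong (τ M) (Π-fix M (<-trans (n<1+n M) M+1<x) x<n) ⟩
    τ M (φ x)                      ≡⟨ τ-fix-above M+1<x x<n ⟩
    φ x                            ∎
    where open ≡-Reasoning

  Π-above : ∀ M {x} → M ≤ N → x < M → P x → Σ[ r ∈ ℕ ] (FirstAbove M x r × Π M (φ x) ≡ φ r)
  Π-above (suc M) {x} M+1≤N x<M+1 Px with P? M | m<1+n⇒m<n∨m≡n x<M+1
  ... | yes PM | inj₂ refl =
    suc M , firstAbove (n<1+n M) ≤-refl (inj₁ refl) (λ w M<w w<M+1 → ⊥-elim (nothing-between M<w w<M+1)) ,
    trans (cong (Π M) (τ-up M)) (Π-fix M (n<1+n M) (s≤s M+1≤N))
  ... | yes PM | inj₁ x<M with Π-above M (<⇒≤ M+1≤N) x<M Px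
  ...   | r , above , Πx≡r =
    r , above-widen above ([ (λ r≡M → subst P (sym r≡M) PM) , (λ Pr → Pr) ]′ (FirstAbove.stops above)) ,
    trans (cong (Π M) (τ-fix-below x<M M+1≤N)) Πx≡r
  Π-above (suc M) M+1≤N x<M+1 Px | no ¬PM | inj₂ refl = ⊥-elim (¬PM Px)
  Π-above (suc M) {x} M+1≤N x<M+1 Px | no ¬PM | inj₁ x<M with Π-above M (<⇒≤ M+1≤N) x<M Px
  ... | r , above , Πx≡r with FirstAbove.stops above
  ...   | inj₁ refl = suc M , above-past above ¬PM ,
    trans (Π-∷ʳ M (φ x)) (trans (cong (τ M) Πx≡r) (τ-up M))
  ...   | inj₂ Pr = r , above-widen above Pr ,
    trans (Π-∷ʳ M (φ x)) (trans (cong (τ M) Πx≡r) (τ-fix-below r<M M+1≤N))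
    where
    r<M = ≤∧≢⇒< (FirstAbove.r≤M above) (λ r≡M → ¬PM (subst P r≡M Pr))

  mutual
    Π-below : ∀ M {x} → M ≤ N → x ≤ M → 0 < x → x ≡ M ⊎ ¬ P x →
              Σ[ r ∈ ℕ ] (LastBelow x r × Π M (φ x) ≡ φ r)
    Π-below zero _ z≤n ()
    Π-below (suc M) {x} M+1≤N x≤M+1 0<x x-cond with P? M | m≤n⇒m<n∨m≡n x≤M+1
    ... | yes PM | inj₂ refl with below-top M (<⇒≤ M+1≤N) PM
    ...   | r , below , ΠM≡r = r , below , trans (cong (Π M) (τ-down M)) ΠM≡r
    Π-below (suc M) {x} M+1≤N x≤M+1 0<x x-cond | yes PM | inj₁ x<M+1
      with Π-below M (<⇒≤ M+1≤N) (≤-pred x<M+1) 0<x (inj₂ (below-bound x<M+1 x-cond))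
    ... | r , below , Πx≡r = r , below , trans (cong (Π M) (τ-fix-below x<M M+1≤N)) Πx≡r
      where
      x<M = ≤∧≢⇒< (≤-pred x<M+1) (λ x≡M → below-bound x<M+1 x-cond (subst P (sym x≡M) PM))
    Π-below (suc M) {x} M+1≤N x≤M+1 0<x x-cond | no ¬PM | inj₂ refl =
      M , lastBelow (n<1+n M) (inj₂ ¬PM) (λ w M<w w<M+1 → ⊥-elim (nothing-between M<w w<M+1)) ,
      trans (Π-∷ʳ M (φ (suc M))) (trans (cong (τ M) (Π-fix M (n<1+n M) (s≤s M+1≤N))) (τ-down M))
    Π-below (suc M) {x} M+1≤N x≤M+1 0<x x-cond | no ¬PM | inj₁ x<M+1
      with Π-below M (<⇒≤ M+1≤N) (≤-pred x<M+1) 0<x (inj₂ (below-bound x<M+1 x-cond))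
    ... | r , below , Πx≡r = r , below ,
      trans (Π-∷ʳ M (φ x)) (trans (cong (τ M) Πx≡r) (τ-fix-below (<-≤-trans (LastBelow.r<x below) (≤-pred x<M+1)) M+1≤N))

    below-top : ∀ M → M ≤ N → P M → Σ[ r ∈ ℕ ] (LastBelow (suc M) r × Π M (φ M) ≡ φ r)
    below-top zero _ _ = 0 , lastBelow (s≤s z≤n) (inj₁ refl) (λ w 0<w w<1 → ⊥-elim (nothing-between 0<w w<1)) , refl
    below-top (suc M) M+1≤N PM+1 with Π-below (suc M) M+1≤N ≤-refl (s≤s z≤n) (inj₁ refl)
    ... | r , below , Π≡r = r , below-extend below PM+1 , Π≡r

-- The construction, given a point u ∉ h followed by next u ∈ h; positions are counted from b = next u,
-- so position 0 lies in h and the last position N does not.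
module Construction (N : ℕ) (h : List (Fin (suc N))) (h-sorted : Sorted h)
                    (u : Fin (suc N)) (u∉h : u ∉ h) (next-u∈h : next u ∈ h) where
  open Rotation N
  open Successors N
  open Positions N (next u)
  open DecMembership (_≟_ {n}) using (_∈?_)
  open Word N (next u) (λ k → φ k ∈? h)

  c : List (Fin n)
  c = ν n ∖ h

  ∈c⁺ : ∀ {v} → v ∉ h → v ∈ c
  ∈c⁺ v∉h = ∈-filter⁺ (λ x → ¬? (x ∈? h)) (∈-allFin _) v∉h

  ∈c⁻ : ∀ {v} → v ∈ c → v ∉ h
  ∈c⁻ v∈c = proj₂ (∈-filter⁻ (λ x → ¬? (x ∈? h)) v∈c)

  c-sorted : Sorted c
  c-sorted = AllPairsₚ.filter⁺ (λ x → ¬? (x ∈? h)) (allFin-sorted n)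

  φ0∈h : φ 0 ∈ h
  φ0∈h = next-u∈h

  φN∉h : φ N ∉ h
  φN∉h = subst (_∉ h) (sym φN≡u) u∉h
    where
    φN≡u : φ N ≡ u
    φN≡u = next-injective φ-n

  below-N : ∀ {x} → x ≤ N → φ x ∈ h → x < N
  below-N x≤N φx∈h = ≤∧≢⇒< x≤N (λ { refl → φN∉h φx∈h })

  above-0 : ∀ {x} → φ x ∉ h → 0 < x
  above-0 {zero} φ0∉h = ⊥-elim (φ0∉h φ0∈h)
  above-0 {suc x} _ = s≤s z≤n

  f : List (Perm n)
  f = map τ (word N ∷ʳ N)

  f-↭ : f ↭ σ n
  f-↭ = transpositions-↭ (↭-trans (↭-sym (∷↭∷ʳ N (word N))) (↭-prep N (word-↭ N)))

  f-on-h : ∀ {x} → x < n → φ x ∈ h → NextIn h (φ x) (○ f (φ x))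
  f-on-h {x} x<n φx∈h with Π-above N ≤-refl (below-N (≤-pred x<n) φx∈h) φx∈h
  ... | r , firstAbove x<r r≤N stops gap , Πx≡r = subst (NextIn h (φ x)) (sym fx≡) (next-in-h stops)
    where
    fx≡ : ○ f (φ x) ≡ τ N (φ r)
    fx≡ = trans (Π-∷ʳ N (φ x)) (cong (τ N) Πx≡r)
    next-in-h : r ≡ N ⊎ φ r ∈ h → NextIn h (φ x) (τ N (φ r))
    next-in-h (inj₁ refl) = subst (NextIn h (φ x)) (sym (τ-up N))
      (nextIn-positions (<-trans x<r (n<1+n N)) (subst (_∈ h) (sym φ-n) φ0∈h) gap′)
      where
      gap′ : ∀ w → x < w → w < n → φ w ∉ h
      gap′ w x<w w<n with m<1+n⇒m<n∨m≡n w<n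
      ... | inj₁ w<N = gap w x<w w<N
      ... | inj₂ refl = φN∉h
    next-in-h (inj₂ φr∈h) = subst (NextIn h (φ x)) (sym (τN-fix (≤-<-trans z≤n x<r) (below-N r≤N φr∈h)))
      (nextIn-positions x<r φr∈h gap)

  f-off-h : ∀ {x} → x < n → φ x ∉ h → ○ f (φ x) ∈ c × NextIn c (○ f (φ x)) (φ x)
  f-off-h {x} x<n φx∉h with Π-below N ≤-refl (≤-pred x<n) (above-0 φx∉h) (inj₂ φx∉h)
  ... | r , lastBelow r<x stops gap , Πx≡r = subst (λ z → z ∈ c × NextIn c z (φ x)) (sym fx≡) (previous-in-c stops)
    where
    fx≡ : ○ f (φ x) ≡ τ N (φ r)
    fx≡ = trans (Π-∷ʳ N (φ x)) (cong (τ N) Πx≡r)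
    previous-in-c : r ≡ 0 ⊎ φ r ∉ h → τ N (φ r) ∈ c × NextIn c (τ N (φ r)) (φ x)
    previous-in-c (inj₁ refl) = subst (λ z → z ∈ c × NextIn c z (φ x)) (sym τN-bottom)
      (∈c⁺ φN∉h , nextIn (suc x) (s≤s z≤n) (φ-wrap x) (∈c⁺ φx∉h) skips)
      where
      skips : ∀ j → 0 < j → j < suc x → rot j (φ N) ∉ c
      skips (suc j) _ j+1<x+1 φj∈c = ∈c⁻ (subst (_∈ c) (φ-wrap j) φj∈c) (in-h j (≤-pred j+1<x+1))
        where
        in-h : ∀ j → j < x → φ j ∈ h
        in-h zero _ = φ0∈h
        in-h (suc j) j+1<x = gap (suc j) (s≤s z≤n) j+1<x
    previous-in-c (inj₂ φr∉h) = subst (λ z → z ∈ c × NextIn c z (φ x)) (sym (τN-fix (above-0 φr∉h) (<-≤-trans r<x (≤-pred x<n))))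
      (∈c⁺ φr∉h , nextIn-positions r<x (∈c⁺ φx∉h) (λ w r<w w<x φw∈c → ∈c⁻ φw∈c (gap w r<w w<x)))

  f-correct : ∀ v → ○ f v ≡ (cyc h ⊙ (cyc c ⁻)) v
  f-correct v with rot-surjective (next u) v
  ... | x , x<n , refl with φ x ∈? h
  ...   | yes φx∈h = begin
    ○ f (φ x)                ≡⟨ cyc⁻-outside c c-sorted _ (λ fx∈c → ∈c⁻ fx∈c (NextIn.member on-h)) ⟨
    (cyc c ⁻) (○ f (φ x))    ≡⟨ cong (cyc c ⁻) (NextIn-functional on-h (cyc-next h h-sorted _ φx∈h)) ⟩
    (cyc c ⁻) (cyc h (φ x))  ∎
    where
    open ≡-Reasoning
    on-h = f-on-h x<n φx∈h
  ...   | no φx∉h = begin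
    ○ f (φ x)                ≡⟨ cyc⁻-predecessor c c-sorted (proj₁ off-h) (proj₂ off-h) ⟨
    (cyc c ⁻) (φ x)          ≡⟨ cong (cyc c ⁻) (cyc-outside h (φ x) φx∉h) ⟨
    (cyc c ⁻) (cyc h (φ x))  ∎
    where
    open ≡-Reasoning
    off-h = f-off-h x<n φx∉h

lemma3p17 : (n : ℕ) → 3 ≤ n → (h : List (Fin n)) → h ⊆ ν n → h ≢ [] → h ≢ ν n →
    Σ[ f ∈ List (Perm n) ] ((f ↭ σ n) × (∀ x → ○ f x ≡ (cyc h ⊙ (cyc (ν n ∖ h) ⁻)) x))
lemma3p17 (suc N) _ h h⊆ν h≢[] h≢ν with Successors.entry-point N h h⊆ν h≢[] h≢ν
... | u , u∉h , next-u∈h = f , f-↭ , f-correct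
  where open Construction N h (sorted-⊆ h⊆ν (allFin-sorted (suc N))) u u∉h next-u∈h
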